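{- There is no misère quotient $(\mathcal{Q},\mathcal{P})$ with $|\mathcal{Q}|=4$, and up to isomorphism there is exactly one misère quotient with $|\mathcal{Q}|=1$, exactly one with $|\mathcal{Q}|=2$, and exactly one with $|\mathcal{Q}|=6$.
   Context: All games are impartial; $G+H$ is the disjunctive sum. In misère play the last player to move loses; $o^-(G)$ is the misère outcome. A set $\mathscr{A}$ of games is closed if it is closed under sums and under taking options. For closed $\mathscr{A}$, $G\equiv_{\mathscr{A}}H$ iff $o^-(G+X)=o^-(H+X)$ for all $X\in\mathscr{A}$; the misère quotient of $\mathscr{A}$ is $(\mathcal{Q},\mathcal{P})$ with $\mathcal{Q}=\mathscr{A}/\equiv_{\mathscr{A}}$ (a commutative monoid) and $\mathcal{P}$ the set of classes of misère $\mathscr{P}$-positions. A misère quotient is any pair arising this way from a closed set. Isomorphism means a monoid isomorphism $f$ with $x\in\mathcal{P}\iff f(x)\in\mathcal{P}'$. -}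

module Defs where

open import Data.Nat using (ℕ; zero; suc)
open import Data.Fin using (Fin; splitAt) renaming (zero to fzero; suc to fsuc)
open import Data.Bool using (Bool; true; false; not; _∧_)
open import Data.Sum using (_⊎_; inj₁; inj₂; [_,_])
open import Data.Product using (Σ; _×_; _,_)
open import Relation.Binary.PropositionalEquality using (_≡_)

data Game : Set where
  node : (n : ℕ) → (Fin n → Game) → Game

𝟘 : Game
𝟘 = node 0 (λ ())

infixl 6 _⊕_
_⊕_ : Game → Game → Game
G@(node m g) ⊕ H@(node n h) =
  node (m Data.Nat.+ n) (λ i → [ (λ a → g a ⊕ H) , (λ b → G ⊕ h b) ] (splitAt m i))

allFin : (n : ℕ) → (Fin n → Bool) → Bool
allFin zero    f = true
allFin (suc n) f = f fzero ∧ allFin n (λ i → f (fsuc i))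

-- Misère outcome: isP G = true iff G is a misère P-position
-- (previous player wins; the player making the last move loses).
isP : Game → Bool
isP (node zero    g) = false
isP (node (suc n) g) = allFin (suc n) (λ i → not (isP (g i)))

record Closed (A : Game → Set) : Set where
  field
    nonempty : Σ Game A
    sum-closed : ∀ {G H} → A G → A H → A (G ⊕ H)
    option-closed : ∀ {n g} → A (node n g) → (i : Fin n) → A (g i)

_≈[_]_ : Game → (Game → Set) → Game → Set
G ≈[ A ] H = ∀ X → A X → isP (G ⊕ X) ≡ isP (H ⊕ X)

QuotientSize : (A : Game → Set) → ℕ → Set
QuotientSize A k =
  Σ (Fin k → Game) λ r →
    (∀ i → A (r i)) ×
    (∀ G → A G → Σ (Fin k) λ i → G ≈[ A ] r i) ×
    (∀ i j → r i ≈[ A ] r j → i ≡ j)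

-- Isomorphism of misère quotients (Q_A, P_A) ≅ (Q_B, P_B), presented on
-- representatives: a map φ on games inducing a well-defined bijective
-- monoid homomorphism A/≡_A → B/≡_B that preserves and reflects the
-- P-portion.
record QIso (A B : Game → Set) : Set where
  field
    φ : Game → Game
    φ-into : ∀ {G} → A G → B (φ G)
    φ-wd : ∀ {G H} → A G → A H → G ≈[ A ] H → φ G ≈[ B ] φ H
    φ-inj : ∀ {G H} → A G → A H → φ G ≈[ B ] φ H → G ≈[ A ] H
    φ-surj : ∀ {K} → B K → Σ Game λ G → A G × (φ G ≈[ B ] K)
    φ-hom : ∀ {G H} → A G → A H → φ (G ⊕ H) ≈[ B ] (φ G ⊕ φ H)
    φ-unit : ∀ {G} → A G → G ≈[ A ] 𝟘 → φ G ≈[ B ] 𝟘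
    φ-P : ∀ {G} → A G → isP G ≡ isP (φ G)

ExactlyOneQuotientOfSize : ℕ → Set₁
ExactlyOneQuotientOfSize k =
  (Σ (Game → Set) λ A → Closed A × QuotientSize A k) ×
  (∀ (A B : Game → Set) → Closed A → Closed B →
     QuotientSize A k → QuotientSize B k → QIso A B)

{-# OPTIONS --safe #-}
module Submission where

-- Inside a closed set A a leaf plays the role of 0. If A has two classes, following options
-- from a game ≢ 0 reaches a game S ≢ 0 whose options are all ≡ 0; it behaves like *, and in
-- particular S + S ≡ 0. If A has three classes, the same descent from a game ≢ 0, S reaches
-- T ≢ 0, S whose options are ≡ 0 or ≡ S, and both kinds occur (otherwise T ≡ S + S ≡ 0 or
-- T ≡ S), so T behaves like *2. The outcome of p·S + q·T is then that of p·* + q·*2, and the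
-- six such sums with p ≤ 1, q ≤ 2 have pairwise different outcomes against each other. Hence
-- three classes force six, and with exactly six classes these sums represent all of them, so
-- the quotient is the quotient T₂ of *2. Likewise two classes are represented by 0 and S,
-- and one class by 0. Sums of nim-heaps of size at most 0, 1 and 2 realise the three cases.

open import Defs
open import Data.Bool using (Bool; true; false; not; _∧_)
open import Data.Bool.Properties using (∧-conicalˡ; ∧-conicalʳ; not-injective; not-involutive)
open import Data.Empty using (⊥-elim)
open import Data.Fin using (Fin; #_; toℕ; _↑ˡ_; _↑ʳ_; splitAt) renaming (zero to fzero; suc to fsuc)
open import Data.Fin.Properties
  using (splitAt-↑ˡ; splitAt-↑ʳ; ¬Fin0; _≟_; any?; all?; ¬∀⟶∃¬; injective⇒≤)
open import Data.Nat using (ℕ; zero; suc; _+_; _%_; _/_; _≤_; _<_; z≤n; s≤s)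
open import Data.Nat.Properties using (1+n≰n; <⇒≱; <⇒≤)
open import Data.Product using (Σ; ∃-syntax; _×_; _,_; proj₁; proj₂)
import Data.Product as Product
open import Data.Sum using (_⊎_; inj₁; inj₂; [_,_]; [_,_]′)
import Data.Sum as Sum
open import Data.Vec.Functional using (_∷_; [])
open import Function using (_∘_; id; case_of_)
open import Function.Definitions using (Injective)
open import Level using (0ℓ)
open import Relation.Binary.Bundles using (Setoid)
import Relation.Binary.Reasoning.Setoid
open import Relation.Binary.PropositionalEquality
  using (_≡_; refl; sym; trans; cong; cong₂; subst; subst₂; module ≡-Reasoning)
open import Relation.Nullary using (¬_; Dec; yes; no; ¬?)
open import Relation.Nullary.Decidable using (decidable-stable)

arity : Game → ℕ
arity (node n _) = n

option : (G : Game) → Fin (arity G) → Game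
option (node _ g) = g

IsLeaf : Game → Set
IsLeaf G = arity G ≡ 0

allFin-true⁻ : ∀ n f → allFin n f ≡ true → ∀ i → f i ≡ true
allFin-true⁻ (suc n) f eq fzero    = ∧-conicalˡ _ _ eq
allFin-true⁻ (suc n) f eq (fsuc i) = allFin-true⁻ n (f ∘ fsuc) (∧-conicalʳ _ _ eq) i

allFin-true⁺ : ∀ n f → (∀ i → f i ≡ true) → allFin n f ≡ true
allFin-true⁺ zero    f _ = refl
allFin-true⁺ (suc n) f h rewrite h fzero = allFin-true⁺ n (f ∘ fsuc) (h ∘ fsuc)

allFin-false⁻ : ∀ n f → allFin n f ≡ false → ∃[ i ] f i ≡ false
allFin-false⁻ (suc n) f eq with f fzero in eq₀
... | false = fzero , eq₀
... | true  = let (i , eqᵢ) = allFin-false⁻ n (f ∘ fsuc) eq in fsuc i , eqᵢ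

isP-nonleaf : ∀ G → isP G ≡ true → Fin (arity G)
isP-nonleaf (node (suc n) g) _ = fzero

isP-option : ∀ G → isP G ≡ true → ∀ i → isP (option G i) ≡ false
isP-option (node (suc n) g) eq i = not-injective (allFin-true⁻ (suc n) (not ∘ isP ∘ g) eq i)

isP-intro : ∀ G → Fin (arity G) → (∀ i → isP (option G i) ≡ false) → isP G ≡ true
isP-intro (node (suc n) g) _ h = allFin-true⁺ (suc n) (not ∘ isP ∘ g) (cong not ∘ h)

isP-false-intro : ∀ G i → isP (option G i) ≡ true → isP G ≡ false
isP-false-intro G i eq with isP G in isP-G
... | false = refl
... | true  = case trans (sym eq) (isP-option G isP-G i) of λ ()

leaf-isP : ∀ G → IsLeaf G → isP G ≡ false
leaf-isP (node zero g) refl = refl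

isP-false-elim : ∀ G → isP G ≡ false → IsLeaf G ⊎ ∃[ i ] isP (option G i) ≡ true
isP-false-elim (node zero    g) _  = inj₁ refl
isP-false-elim (node (suc n) g) eq =
  let (i , eqᵢ) = allFin-false⁻ (suc n) (not ∘ isP ∘ g) eq in inj₂ (i , not-injective eqᵢ)

⊕-option : ∀ G H i →
  (∃[ a ] option (G ⊕ H) i ≡ option G a ⊕ H) ⊎ (∃[ b ] option (G ⊕ H) i ≡ G ⊕ option H b)
⊕-option (node m g) (node n h) i with splitAt m i
... | inj₁ a = inj₁ (a , refl)
... | inj₂ b = inj₂ (b , refl)

⊕-optionˡ : ∀ G H a → ∃[ i ] option (G ⊕ H) i ≡ option G a ⊕ H
⊕-optionˡ G@(node m g) H@(node n h) a =
  a ↑ˡ n , cong [ (λ a → g a ⊕ H) , (λ b → G ⊕ h b) ] (splitAt-↑ˡ m a n)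

⊕-optionʳ : ∀ G H b → ∃[ i ] option (G ⊕ H) i ≡ G ⊕ option H b
⊕-optionʳ G@(node m g) H@(node n h) b =
  m ↑ʳ b , cong [ (λ a → g a ⊕ H) , (λ b → G ⊕ h b) ] (splitAt-↑ʳ m n b)

Match : (Game → Game → Set) → Game → Game → Set
Match R G H = (∀ i → ∃[ j ] R (option G i) (option H j))
            × (∀ j → ∃[ i ] R (option G i) (option H j))

module _ (R : Game → Game → Set) where

  partnerˡ : ∀ {X} G H a → R X (option G a ⊕ H) → ∃[ i ] R X (option (G ⊕ H) i)
  partnerˡ G H a r = let (i , eq) = ⊕-optionˡ G H a in i , subst (R _) (sym eq) r

  partnerʳ : ∀ {X} G H b → R X (G ⊕ option H b) → ∃[ i ] R X (option (G ⊕ H) i)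
  partnerʳ G H b r = let (i , eq) = ⊕-optionʳ G H b in i , subst (R _) (sym eq) r

  viaˡ : ∀ {Y} G H a → R (option G a ⊕ H) Y → ∃[ i ] R (option (G ⊕ H) i) Y
  viaˡ G H a r = let (i , eq) = ⊕-optionˡ G H a in i , subst (λ Z → R Z _) (sym eq) r

  viaʳ : ∀ {Y} G H b → R (G ⊕ option H b) Y → ∃[ i ] R (option (G ⊕ H) i) Y
  viaʳ G H b r = let (i , eq) = ⊕-optionʳ G H b in i , subst (λ Z → R Z _) (sym eq) r

  Match-⊕ : ∀ G H K →
    (∀ a → ∃[ j ] R (option G a ⊕ H) (option K j)) →
    (∀ b → ∃[ j ] R (G ⊕ option H b) (option K j)) →
    (∀ j → (∃[ a ] R (option G a ⊕ H) (option K j)) ⊎ (∃[ b ] R (G ⊕ option H b) (option K j))) →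
    Match R (G ⊕ H) K
  Match-⊕ G H K forthˡ forthʳ back = forth , back′
    where
    forth : ∀ i → ∃[ j ] R (option (G ⊕ H) i) (option K j)
    forth i with ⊕-option G H i
    ... | inj₁ (a , eq) = let (j , r) = forthˡ a in j , subst (λ Z → R Z _) (sym eq) r
    ... | inj₂ (b , eq) = let (j , r) = forthʳ b in j , subst (λ Z → R Z _) (sym eq) r
    back′ : ∀ j → ∃[ i ] R (option (G ⊕ H) i) (option K j)
    back′ j with back j
    ... | inj₁ (a , r) = viaˡ G H a r
    ... | inj₂ (b , r) = viaʳ G H b r

SameOutcome : Game → Game → Set
SameOutcome G H = isP G ≡ isP H

isP-match-true : ∀ G H → Match SameOutcome G H → isP G ≡ true → isP H ≡ true
isP-match-true G H (forth , back) P-G =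
  isP-intro H (proj₁ (forth (isP-nonleaf G P-G)))
    (λ j → let (i , eq) = back j in trans (sym eq) (isP-option G P-G i))

isP-match : ∀ G H → Match SameOutcome G H → isP G ≡ isP H
isP-match G H m@(forth , back) with isP G in P-G | isP H in P-H
... | false | false = refl
... | true  | true  = refl
... | true  | false = case trans (sym (isP-match-true G H m P-G)) P-H of λ ()
... | false | true  = case trans (sym (isP-match-true H G flipped P-H)) P-G of λ ()
  where
  flipped : Match SameOutcome H G
  flipped = (λ j → let (i , eq) = back j in i , sym eq) , (λ i → let (j , eq) = forth i in j , sym eq)

-- Bisimilarity

-- ⊕ is commutative, associative and unital only up to Sim, since it reindexes options.
data Sim (G H : Game) : Set where
  sim : Match Sim G H → Sim G H

Sim-refl : ∀ {G} → Sim G G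
Sim-refl {node m g} = sim ((λ i → i , Sim-refl {g i}) , (λ i → i , Sim-refl {g i}))

Sim-sym : ∀ {G H} → Sim G H → Sim H G
Sim-sym (sim (forth , back)) =
  sim ((λ j → let (i , s) = back j in i , Sim-sym s) , (λ i → let (j , s) = forth i in j , Sim-sym s))

Sim-trans : ∀ {G H K} → Sim G H → Sim H K → Sim G K
Sim-trans (sim (forth₁ , back₁)) (sim (forth₂ , back₂)) =
  sim ((λ i → let (j , s) = forth₁ i ; (c , t) = forth₂ j in c , Sim-trans s t) ,
       (λ c → let (j , t) = back₂ c ; (i , s) = back₁ j in i , Sim-trans s t))

Sim-setoid : Setoid 0ℓ 0ℓ
Sim-setoid = record
  { Carrier = Game ; _≈_ = Sim
  ; isEquivalence = record { refl = Sim-refl ; sym = Sim-sym ; trans = Sim-trans } }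

Sim-isP : ∀ {G H} → Sim G H → isP G ≡ isP H
Sim-isP {G} {H} (sim (forth , back)) = isP-match G H
  ((λ i → let (j , s) = forth i in j , Sim-isP s) , (λ j → let (i , s) = back j in i , Sim-isP s))

Sim-leaves : ∀ {G H} → IsLeaf G → IsLeaf H → Sim G H
Sim-leaves {node zero _} {node zero _} refl refl = sim ((λ ()) , (λ ()))

Sim-⊕ : ∀ {G G' H H'} → Sim G G' → Sim H H' → Sim (G ⊕ H) (G' ⊕ H')
Sim-⊕ {G@(node _ g)} {G'} {H@(node _ h)} {H'} sG@(sim (forthᴳ , backᴳ)) sH@(sim (forthᴴ , backᴴ)) =
  ⊕-cong (λ a s → Sim-⊕ {g a} s sH) (λ b s → Sim-⊕ {H = h b} sG s)
  where
  ⊕-cong : (∀ a {X} → Sim (g a) X → Sim (g a ⊕ H) (X ⊕ H')) →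
           (∀ b {Y} → Sim (h b) Y → Sim (G ⊕ h b) (G' ⊕ Y)) →
           Sim (G ⊕ H) (G' ⊕ H')
  ⊕-cong ihˡ ihʳ = sim (Match-⊕ Sim G H (G' ⊕ H') forthˡ forthʳ back)
    where
    forthˡ : ∀ a → ∃[ j ] Sim (g a ⊕ H) (option (G' ⊕ H') j)
    forthˡ a = let (a' , s) = forthᴳ a in partnerˡ Sim G' H' a' (ihˡ a s)
    forthʳ : ∀ b → ∃[ j ] Sim (G ⊕ h b) (option (G' ⊕ H') j)
    forthʳ b = let (b' , s) = forthᴴ b in partnerʳ Sim G' H' b' (ihʳ b s)
    back : ∀ j → (∃[ a ] Sim (g a ⊕ H) (option (G' ⊕ H') j))
               ⊎ (∃[ b ] Sim (G ⊕ h b) (option (G' ⊕ H') j))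
    back j with ⊕-option G' H' j
    ... | inj₁ (a' , eq) = let (a , s) = backᴳ a' in inj₁ (a , subst (Sim _) (sym eq) (ihˡ a s))
    ... | inj₂ (b' , eq) = let (b , s) = backᴴ b' in inj₂ (b , subst (Sim _) (sym eq) (ihʳ b s))

Sim-comm : ∀ G H → Sim (G ⊕ H) (H ⊕ G)
Sim-comm G@(node _ g) H@(node _ h) = comm (λ a → Sim-comm (g a) H) (λ b → Sim-comm G (h b))
  where
  comm : (∀ a → Sim (g a ⊕ H) (H ⊕ g a)) → (∀ b → Sim (G ⊕ h b) (h b ⊕ G)) → Sim (G ⊕ H) (H ⊕ G)
  comm ihˡ ihʳ = sim (Match-⊕ Sim G H (H ⊕ G)
    (λ a → partnerʳ Sim H G a (ihˡ a)) (λ b → partnerˡ Sim H G b (ihʳ b)) back)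
    where
    back : ∀ j → (∃[ a ] Sim (g a ⊕ H) (option (H ⊕ G) j)) ⊎ (∃[ b ] Sim (G ⊕ h b) (option (H ⊕ G) j))
    back j with ⊕-option H G j
    ... | inj₁ (b , eq) = inj₂ (b , subst (Sim _) (sym eq) (ihʳ b))
    ... | inj₂ (a , eq) = inj₁ (a , subst (Sim _) (sym eq) (ihˡ a))

Sim-assoc : ∀ G H K → Sim ((G ⊕ H) ⊕ K) (G ⊕ (H ⊕ K))
Sim-assoc G@(node _ g) H@(node _ h) K@(node _ k) =
  assoc (λ a → Sim-assoc (g a) H K) (λ b → Sim-assoc G (h b) K) (λ c → Sim-assoc G H (k c))
  where
  assoc : (∀ a → Sim ((g a ⊕ H) ⊕ K) (g a ⊕ (H ⊕ K))) →
          (∀ b → Sim ((G ⊕ h b) ⊕ K) (G ⊕ (h b ⊕ K))) →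
          (∀ c → Sim ((G ⊕ H) ⊕ k c) (G ⊕ (H ⊕ k c))) →
          Sim ((G ⊕ H) ⊕ K) (G ⊕ (H ⊕ K))
  assoc ihᴳ ihᴴ ihᴷ = sim (Match-⊕ Sim (G ⊕ H) K (G ⊕ (H ⊕ K)) forthᴳᴴ forthᴷ back)
    where
    forthᴳᴴ : ∀ i → ∃[ j ] Sim (option (G ⊕ H) i ⊕ K) (option (G ⊕ (H ⊕ K)) j)
    forthᴳᴴ i with ⊕-option G H i
    ... | inj₁ (a , eq) = partnerˡ Sim G (H ⊕ K) a (subst (λ Y → Sim (Y ⊕ K) _) (sym eq) (ihᴳ a))
    ... | inj₂ (b , eq) = let (c , eq′) = ⊕-optionˡ H K b in
      partnerʳ Sim G (H ⊕ K) c (subst₂ (λ Y Z → Sim (Y ⊕ K) (G ⊕ Z)) (sym eq) (sym eq′) (ihᴴ b))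
    forthᴷ : ∀ c → ∃[ j ] Sim ((G ⊕ H) ⊕ k c) (option (G ⊕ (H ⊕ K)) j)
    forthᴷ c = let (d , eq) = ⊕-optionʳ H K c in
      partnerʳ Sim G (H ⊕ K) d (subst (λ Z → Sim _ (G ⊕ Z)) (sym eq) (ihᴷ c))
    back : ∀ j → (∃[ i ] Sim (option (G ⊕ H) i ⊕ K) (option (G ⊕ (H ⊕ K)) j))
               ⊎ (∃[ c ] Sim ((G ⊕ H) ⊕ k c) (option (G ⊕ (H ⊕ K)) j))
    back j with ⊕-option G (H ⊕ K) j
    ... | inj₁ (a , eq) = let (i , eq′) = ⊕-optionˡ G H a in
      inj₁ (i , subst₂ (λ Y Z → Sim (Y ⊕ K) Z) (sym eq′) (sym eq) (ihᴳ a))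
    ... | inj₂ (d , eq) with ⊕-option H K d
    ...   | inj₁ (b , eq′) = let (i , eq″) = ⊕-optionʳ G H b in
      inj₁ (i , subst₂ (λ Y Z → Sim (Y ⊕ K) Z) (sym eq″)
                  (trans (sym (cong (G ⊕_) eq′)) (sym eq)) (ihᴴ b))
    ...   | inj₂ (c , eq′) = inj₂ (c , subst (Sim _) (trans (sym (cong (G ⊕_) eq′)) (sym eq)) (ihᴷ c))

Sim-identityʳ : ∀ G L → IsLeaf L → Sim (G ⊕ L) G
Sim-identityʳ G@(node _ g) L@(node zero _) refl = sim (Match-⊕ Sim G L G
  (λ a → a , Sim-identityʳ (g a) L refl) (λ ()) (λ a → inj₁ (a , Sim-identityʳ (g a) L refl)))

Sim-identityˡ : ∀ G L → IsLeaf L → Sim (L ⊕ G) G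
Sim-identityˡ G L leaf = Sim-trans (Sim-comm L G) (Sim-identityʳ G L leaf)

Sim-swap : ∀ G H K → Sim (G ⊕ (H ⊕ K)) (H ⊕ (G ⊕ K))
Sim-swap G H K = Sim-trans (Sim-sym (Sim-assoc G H K))
                           (Sim-trans (Sim-⊕ (Sim-comm G H) Sim-refl) (Sim-assoc H G K))

copies : ℕ → Game → Game → Game
copies zero    S X = X
copies (suc p) S X = S ⊕ copies p S X

copies-+ : ∀ p p' S X → copies (p + p') S X ≡ copies p S (copies p' S X)
copies-+ zero    p' S X = refl
copies-+ (suc p) p' S X = cong (S ⊕_) (copies-+ p p' S X)

copies-cong : ∀ p {S X Y} → Sim X Y → Sim (copies p S X) (copies p S Y)
copies-cong zero    s = s
copies-cong (suc p) s = Sim-⊕ Sim-refl (copies-cong p s)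

copies-⊕ˡ : ∀ p S X Y → Sim (copies p S X ⊕ Y) (copies p S (X ⊕ Y))
copies-⊕ˡ zero    S X Y = Sim-refl
copies-⊕ˡ (suc p) S X Y = Sim-trans (Sim-assoc S (copies p S X) Y) (Sim-⊕ Sim-refl (copies-⊕ˡ p S X Y))

copies-⊕ʳ : ∀ p S X Y → Sim (X ⊕ copies p S Y) (copies p S (X ⊕ Y))
copies-⊕ʳ zero    S X Y = Sim-refl
copies-⊕ʳ (suc p) S X Y = Sim-trans (Sim-swap X S (copies p S Y)) (Sim-⊕ Sim-refl (copies-⊕ʳ p S X Y))

-- The quotient T₂ of *2

odd : ℕ → Bool
odd zero    = false
odd (suc n) = not (odd n)

-- p·S + q·T is a P-position iff its image aᵖbᵠ in T₂ = ⟨a, b ∣ a² = 1, b³ = b⟩ is a or b².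
inP : ℕ → ℕ → Bool
inP p zero    = odd p
inP p (suc q) = not (odd p) ∧ odd q

-- The moves of p·S + q·T up to equivalence: S to 0, T to 0 and T to S.
data Move : ℕ → ℕ → ℕ → ℕ → Set where
  S-move  : ∀ {p q} → Move (suc p) q p q
  T-move₀ : ∀ {p q} → Move p (suc q) p q
  T-move₁ : ∀ {p q} → Move p (suc q) (suc p) q

inP-true-move : ∀ p q → inP p q ≡ true → ∃[ p' ] ∃[ q' ] Move p q p' q'
inP-true-move (suc p) q       _ = p , q , S-move
inP-true-move zero    (suc q) _ = 0 , q , T-move₀

inP-true : ∀ p q → inP p q ≡ true → ∀ {p' q'} → Move p q p' q' → inP p' q' ≡ false
inP-true (suc p) zero    P S-move with odd p
... | false = refl
inP-true (suc p) zero    () S-move | true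
inP-true (suc p) (suc q) P S-move with odd p
... | true  = refl
inP-true (suc p) (suc q) () S-move | false
inP-true p (suc zero) P T-move₀ with odd p
inP-true p (suc zero) () T-move₀ | true
inP-true p (suc zero) () T-move₀ | false
inP-true p (suc (suc q)) P T-move₀ with odd p | odd q
... | true  | _     = refl
... | false | false = refl
inP-true p (suc (suc q)) () T-move₀ | false | true
inP-true p (suc zero) P T-move₁ with odd p
inP-true p (suc zero) () T-move₁ | true
inP-true p (suc zero) () T-move₁ | false
inP-true p (suc (suc q)) P T-move₁ with odd p
... | false = refl
inP-true p (suc (suc q)) () T-move₁ | true

inP-false : ∀ p q → inP p q ≡ false →
  (p ≡ 0 × q ≡ 0) ⊎ ∃[ p' ] ∃[ q' ] Move p q p' q' × inP p' q' ≡ true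
inP-false zero    zero    _ = inj₁ (refl , refl)
inP-false (suc p) zero    N with odd p in odd-p
... | true = inj₂ (p , 0 , S-move , odd-p)
inP-false (suc p) zero    () | false
inP-false p (suc zero) _ with odd p in odd-p
... | true  = inj₂ (p , 0 , T-move₀ , odd-p)
... | false = inj₂ (suc p , 0 , T-move₁ , cong not odd-p)
inP-false zero (suc (suc q)) N with odd q in odd-q
... | true = inj₂ (0 , suc q , T-move₀ , odd-q)
inP-false zero (suc (suc q)) () | false
inP-false (suc p) (suc (suc q)) N with odd p in odd-p | odd q in odd-q
... | false | false = inj₂ (p , suc (suc q) , S-move , cong₂ (λ a b → not a ∧ not b) odd-p odd-q)
... | false | true  =
  inj₂ (suc (suc p) , suc q , T-move₁ , cong₂ (λ a b → not (not (not a)) ∧ b) odd-p odd-q)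
... | true  | true  = inj₂ (suc p , suc q , T-move₀ , cong₂ (λ a b → not (not a) ∧ b) odd-p odd-q)
inP-false (suc p) (suc (suc q)) () | true | false

module Sums (L S T : Game) (L-leaf : IsLeaf L) where

  ⟪_,_⟫ : ℕ → ℕ → Game
  ⟪ p , q ⟫ = copies p S (copies q T L)

  ⟪⟫-⊕ : ∀ p q p' q' → Sim (⟪ p , q ⟫ ⊕ ⟪ p' , q' ⟫) ⟪ p + p' , q + q' ⟫
  ⟪⟫-⊕ p q p' q' = begin
    copies p S X ⊕ copies p' S Y                    ≈⟨ copies-⊕ˡ p S X (copies p' S Y) ⟩
    copies p S (X ⊕ copies p' S Y)                  ≈⟨ copies-cong p (copies-⊕ʳ p' S X Y) ⟩
    copies p S (copies p' S (X ⊕ Y))                ≈⟨ copies-cong p (copies-cong p' T-part) ⟩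
    copies p S (copies p' S (copies (q + q') T L))  ≡⟨ copies-+ p p' S _ ⟨
    ⟪ p + p' , q + q' ⟫                             ∎
    where
    open Relation.Binary.Reasoning.Setoid Sim-setoid
    X = copies q T L
    Y = copies q' T L
    T-part : Sim (X ⊕ Y) (copies (q + q') T L)
    T-part = begin
      X ⊕ Y              ≈⟨ copies-⊕ˡ q T L Y ⟩
      copies q T (L ⊕ Y) ≈⟨ copies-cong q (Sim-identityˡ Y L L-leaf) ⟩
      copies q T Y       ≡⟨ copies-+ q q' T L ⟨
      copies (q + q') T L ∎

  -- R is Sim for concrete games and ≈ inside a closed set; the hypotheses say that S acts
  -- like * and T like *2 on the sums ⟪ p , q ⟫.
  module Outcomes
    (R : Game → Game → Set)
    (R-trans : ∀ {G H K} → R G H → R H K → R G K)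
    (Sim⇒R : ∀ {G H} → Sim G H → R G H)
    (R⇒isP : ∀ {G H} → R G H → isP G ≡ isP H)
    (S-cong : ∀ {G H} → R G H → R (S ⊕ G) (S ⊕ H))
    (T-cong : ∀ {G H} → R G H → R (T ⊕ G) (T ⊕ H))
    (S-nonleaf : Fin (arity S))
    (S-option : ∀ a p q → R (option S a ⊕ ⟪ p , q ⟫) ⟪ p , q ⟫)
    (T-option : ∀ b → (∀ q → R (option T b ⊕ ⟪ 0 , q ⟫) ⟪ 0 , q ⟫)
                    ⊎ (∀ q → R (option T b ⊕ ⟪ 0 , q ⟫) ⟪ 1 , q ⟫))
    (T-option₀ : ∃[ b ] ∀ q → R (option T b ⊕ ⟪ 0 , q ⟫) ⟪ 0 , q ⟫)
    (T-option₁ : ∃[ b ] ∀ q → R (option T b ⊕ ⟪ 0 , q ⟫) ⟪ 1 , q ⟫)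
    where

    S-lift : ∀ {p q p' q'} → Move p q p' q' → Move (suc p) q (suc p') q'
    S-lift S-move  = S-move
    S-lift T-move₀ = T-move₀
    S-lift T-move₁ = T-move₁

    T-lift : ∀ {p q p' q'} → Move p q p' q' → Move p (suc q) p' (suc q')
    T-lift S-move  = S-move
    T-lift T-move₀ = T-move₀
    T-lift T-move₁ = T-move₁

    option-move : ∀ p q i → ∃[ p' ] ∃[ q' ] Move p q p' q' × R (option ⟪ p , q ⟫ i) ⟪ p' , q' ⟫
    option-move (suc p) q i with ⊕-option S ⟪ p , q ⟫ i
    ... | inj₁ (a , eq) = p , q , S-move , subst (λ Z → R Z _) (sym eq) (S-option a p q)
    ... | inj₂ (j , eq) = let (p' , q' , mv , r) = option-move p q j in
      suc p' , q' , S-lift mv , subst (λ Z → R Z _) (sym eq) (S-cong r)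
    option-move zero zero i = ⊥-elim (¬Fin0 (subst Fin L-leaf i))
    option-move zero (suc q) i with ⊕-option T ⟪ 0 , q ⟫ i
    ... | inj₁ (b , eq) =
      [ (λ acts₀ → 0 , q , T-move₀ , subst (λ Z → R Z _) (sym eq) (acts₀ q))
      , (λ acts₁ → 1 , q , T-move₁ , subst (λ Z → R Z _) (sym eq) (acts₁ q)) ] (T-option b)
    ... | inj₂ (j , eq) = let (p' , q' , mv , r) = option-move 0 q j in
      p' , suc q' , T-lift mv ,
      subst (λ Z → R Z _) (sym eq) (R-trans (T-cong r) (Sim⇒R (copies-⊕ʳ p' S T (copies q' T L))))

    move-option : ∀ {p q p' q'} → Move p q p' q' → ∃[ i ] R (option ⟪ p , q ⟫ i) ⟪ p' , q' ⟫
    move-option (S-move {p} {q}) = viaˡ R S ⟪ p , q ⟫ S-nonleaf (S-option S-nonleaf p q)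
    move-option (T-move₀ {zero} {q}) =
      let (b , acts₀) = T-option₀ in viaˡ R T ⟪ 0 , q ⟫ b (acts₀ q)
    move-option (T-move₁ {zero} {q}) =
      let (b , acts₁) = T-option₁ in viaˡ R T ⟪ 0 , q ⟫ b (acts₁ q)
    move-option (T-move₀ {suc p} {q}) =
      let (j , r) = move-option (T-move₀ {p} {q}) in viaʳ R S ⟪ p , suc q ⟫ j (S-cong r)
    move-option (T-move₁ {suc p} {q}) =
      let (j , r) = move-option (T-move₁ {p} {q}) in viaʳ R S ⟪ p , suc q ⟫ j (S-cong r)

    isP-⟪⟫-step : ∀ p q → (∀ {p' q'} → Move p q p' q' → isP ⟪ p' , q' ⟫ ≡ inP p' q') →
                  isP ⟪ p , q ⟫ ≡ inP p q
    isP-⟪⟫-step p q ih with inP p q in P-pq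
    ... | true = isP-intro ⟪ p , q ⟫ (proj₁ (move-option (proj₂ (proj₂ (inP-true-move p q P-pq)))))
      λ i → let (p' , q' , mv , r) = option-move p q i in
        trans (R⇒isP r) (trans (ih mv) (inP-true p q P-pq mv))
    ... | false with inP-false p q P-pq
    ...   | inj₁ (refl , refl) = leaf-isP L L-leaf
    ...   | inj₂ (p' , q' , mv , P-p'q') = let (i , r) = move-option mv in
      isP-false-intro ⟪ p , q ⟫ i (trans (R⇒isP r) (trans (ih mv) P-p'q'))

    mutual
      isP-⟪⟫ : ∀ p q → isP ⟪ p , q ⟫ ≡ inP p q
      isP-⟪⟫ p q = isP-⟪⟫-step p q (isP-⟪⟫-after p q)

      isP-⟪⟫-after : ∀ p q {p' q'} → Move p q p' q' → isP ⟪ p' , q' ⟫ ≡ inP p' q'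
      isP-⟪⟫-after (suc p) q       S-move  = isP-⟪⟫ p q
      isP-⟪⟫-after p       (suc q) T-move₀ = isP-⟪⟫ p q
      isP-⟪⟫-after p       (suc q) T-move₁ = isP-⟪⟫ (suc p) q

    isP-⟪⟫-⊕ : ∀ p q p' q' → isP (⟪ p , q ⟫ ⊕ ⟪ p' , q' ⟫) ≡ inP (p + p') (q + q')
    isP-⟪⟫-⊕ p q p' q' = trans (Sim-isP (⟪⟫-⊕ p q p' q')) (isP-⟪⟫ (p + p') (q + q'))

p-of q-of : Fin 6 → ℕ
p-of c = toℕ c % 2
q-of c = toℕ c / 2

table₆ : Fin 6 → Fin 6 → Bool
table₆ c k = inP (p-of c + p-of k) (q-of c + q-of k)

-- The columns # 0, # 1, # 2 and # 4 of the outcome table already tell its six rows apart.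
decode : (Fin 6 → Bool) → Fin 6
decode f = bits (f (# 0)) (f (# 1)) (f (# 2)) (f (# 4))
  where
  bits : Bool → Bool → Bool → Bool → Fin 6
  bits true  _     _     true  = # 4
  bits true  _     _     false = # 1
  bits false true  _     true  = # 0
  bits false true  _     false = # 5
  bits false false true  _     = # 2
  bits false false false _     = # 3

decode-cong : ∀ {f g} → (∀ k → f k ≡ g k) → decode f ≡ decode g
decode-cong {f} {g} f≗g rewrite f≗g (# 0) | f≗g (# 1) | f≗g (# 2) | f≗g (# 4) = refl

decode-table₆ : ∀ c → decode (table₆ c) ≡ c
decode-table₆ fzero                                     = refl
decode-table₆ (fsuc fzero)                              = refl
decode-table₆ (fsuc (fsuc fzero))                       = refl
decode-table₆ (fsuc (fsuc (fsuc fzero)))                = refl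
decode-table₆ (fsuc (fsuc (fsuc (fsuc fzero))))         = refl
decode-table₆ (fsuc (fsuc (fsuc (fsuc (fsuc fzero))))) = refl

table₆-injective : ∀ {c d} → (∀ k → table₆ c k ≡ table₆ d k) → c ≡ d
table₆-injective {c} {d} eq = trans (sym (decode-table₆ c)) (trans (decode-cong eq) (decode-table₆ d))

inP-2+ : ∀ p q → inP (2 + p) q ≡ inP p q
inP-2+ p zero    = not-involutive (odd p)
inP-2+ p (suc q) = cong (λ b → not b ∧ odd q) (not-involutive (odd p))

inP-3+ : ∀ p q → inP p (3 + q) ≡ inP p (1 + q)
inP-3+ p q = cong (not (odd p) ∧_) (not-involutive (odd q))

representative : ∀ p q → ∃[ c ] ∀ p' q' → inP (p + p') (q + q') ≡ inP (p-of c + p') (q-of c + q')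
representative (suc (suc p)) q =
  let (c , same) = representative p q in c , λ p' q' → trans (inP-2+ (p + p') (q + q')) (same p' q')
representative zero       zero             = # 0 , λ _ _ → refl
representative (suc zero) zero             = # 1 , λ _ _ → refl
representative zero       (suc zero)       = # 2 , λ _ _ → refl
representative (suc zero) (suc zero)       = # 3 , λ _ _ → refl
representative zero       (suc (suc zero)) = # 4 , λ _ _ → refl
representative (suc zero) (suc (suc zero)) = # 5 , λ _ _ → refl
representative zero (suc (suc (suc q))) =
  let (c , same) = representative 0 (suc q) in c , λ p' q' → trans (inP-3+ p' (q + q')) (same p' q')
representative (suc zero) (suc (suc (suc q))) =
  let (c , same) = representative 1 (suc q) in
  c , λ p' q' → trans (inP-3+ (suc p') (q + q')) (same p' q')

_∙₆_ : Fin 6 → Fin 6 → Fin 6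
c ∙₆ d = decode (λ k → inP (p-of c + p-of d + p-of k) (q-of c + q-of d + q-of k))

P₆ : Fin 6 → Bool
P₆ c = inP (p-of c) (q-of c)

_∙₂_ : Fin 2 → Fin 2 → Fin 2
fzero      ∙₂ d          = d
fsuc fzero ∙₂ fzero      = fsuc fzero
fsuc fzero ∙₂ fsuc fzero = fzero

P₂ : Fin 2 → Bool
P₂ fzero      = false
P₂ (fsuc _)   = true

bit : Bool → Fin 2
bit false = fzero
bit true  = fsuc fzero

nonleaf : ∀ G → ¬ IsLeaf G → Fin (arity G)
nonleaf (node zero    _) ¬leaf = ⊥-elim (¬leaf refl)
nonleaf (node (suc n) _) _     = fzero

-- Equivalence modulo a closed set

module ClosedSet {A : Game → Set} (cl : Closed A) where
  open Closed cl

  -- A record, so that the two games can be inferred from its type.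
  infix 4 _≈_
  record _≈_ (G H : Game) : Set where
    constructor mk≈
    field outcomes : G ≈[ A ] H
  open _≈_ public

  ≈-refl : ∀ {G} → G ≈ G
  ≈-refl = mk≈ λ _ _ → refl

  ≈-sym : ∀ {G H} → G ≈ H → H ≈ G
  ≈-sym (mk≈ e) = mk≈ λ X X∈ → sym (e X X∈)

  ≈-trans : ∀ {G H K} → G ≈ H → H ≈ K → G ≈ K
  ≈-trans (mk≈ e) (mk≈ f) = mk≈ λ X X∈ → trans (e X X∈) (f X X∈)

  ≈-setoid : Setoid 0ℓ 0ℓ
  ≈-setoid = record
    { Carrier = Game ; _≈_ = _≈_
    ; isEquivalence = record { refl = ≈-refl ; sym = ≈-sym ; trans = ≈-trans } }

  module ≈-Reasoning = Relation.Binary.Reasoning.Setoid ≈-setoid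

  option∈ : ∀ {G} → A G → ∀ i → A (option G i)
  option∈ {node _ _} = option-closed

  copies∈ : ∀ p {S X} → A S → A X → A (copies p S X)
  copies∈ zero    S∈ X∈ = X∈
  copies∈ (suc p) S∈ X∈ = sum-closed S∈ (copies∈ p S∈ X∈)

  Sim⇒≈ : ∀ {G H} → Sim G H → G ≈ H
  Sim⇒≈ s = mk≈ λ X _ → Sim-isP (Sim-⊕ s (Sim-refl {X}))

  ⊕-congˡ : ∀ {G G' H} → A H → G ≈ G' → G ⊕ H ≈ G' ⊕ H
  ⊕-congˡ {G} {G'} {H} H∈ (mk≈ e) = mk≈ λ X X∈ → begin
    isP ((G ⊕ H) ⊕ X)   ≡⟨ Sim-isP (Sim-assoc G H X) ⟩
    isP (G ⊕ (H ⊕ X))   ≡⟨ e (H ⊕ X) (sum-closed H∈ X∈) ⟩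
    isP (G' ⊕ (H ⊕ X))  ≡⟨ Sim-isP (Sim-assoc G' H X) ⟨
    isP ((G' ⊕ H) ⊕ X)  ∎
    where open ≡-Reasoning

  ⊕-congʳ : ∀ {G H H'} → A G → H ≈ H' → G ⊕ H ≈ G ⊕ H'
  ⊕-congʳ {G} {H} {H'} G∈ e = begin
    G ⊕ H   ≈⟨ Sim⇒≈ (Sim-comm G H) ⟩
    H ⊕ G   ≈⟨ ⊕-congˡ G∈ e ⟩
    H' ⊕ G  ≈⟨ Sim⇒≈ (Sim-comm H' G) ⟩
    G ⊕ H'  ∎
    where open ≈-Reasoning

  private
    first-leaf : ∀ G → A G → ∃[ L ] A L × IsLeaf L
    first-leaf (node zero    g) G∈ = node zero g , G∈ , refl
    first-leaf (node (suc n) g) G∈ = first-leaf (g fzero) (option-closed G∈ fzero)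

  leaf : Game
  leaf = proj₁ (first-leaf _ (proj₂ nonempty))

  leaf∈ : A leaf
  leaf∈ = proj₁ (proj₂ (first-leaf _ (proj₂ nonempty)))

  leaf-isLeaf : IsLeaf leaf
  leaf-isLeaf = proj₂ (proj₂ (first-leaf _ (proj₂ nonempty)))

  isP-leaf : isP leaf ≡ false
  isP-leaf = leaf-isP leaf leaf-isLeaf

  IsLeaf⇒≈leaf : ∀ {G} → IsLeaf G → G ≈ leaf
  IsLeaf⇒≈leaf G-leaf = Sim⇒≈ (Sim-leaves G-leaf leaf-isLeaf)

  ≈⇒isP : ∀ {G H} → G ≈ H → isP G ≡ isP H
  ≈⇒isP {G} {H} (mk≈ e) = begin
    isP G           ≡⟨ Sim-isP (Sim-identityʳ G leaf leaf-isLeaf) ⟨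
    isP (G ⊕ leaf)  ≡⟨ e leaf leaf∈ ⟩
    isP (H ⊕ leaf)  ≡⟨ Sim-isP (Sim-identityʳ H leaf leaf-isLeaf) ⟩
    isP H           ∎
    where open ≡-Reasoning

  ≈leaf-⊕ : ∀ {G X} → A X → G ≈ leaf → G ⊕ X ≈ X
  ≈leaf-⊕ {X = X} X∈ G≈leaf = ≈-trans (⊕-congˡ X∈ G≈leaf) (Sim⇒≈ (Sim-identityˡ X leaf leaf-isLeaf))

  ≈-by-options : ∀ {G H} → Match _≈_ G H → G ≈ H
  ≈-by-options {G} {H} (forth , back) = mk≈ outcome
    where
    outcome : ∀ X → A X → isP (G ⊕ X) ≡ isP (H ⊕ X)
    outcome X@(node _ x) X∈ = from-options (λ b → outcome (x b) (option-closed X∈ b))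
      where
      from-options : (∀ b → isP (G ⊕ x b) ≡ isP (H ⊕ x b)) → isP (G ⊕ X) ≡ isP (H ⊕ X)
      from-options ih = isP-match (G ⊕ X) (H ⊕ X) (Match-⊕ SameOutcome G X (H ⊕ X) forthᴳ forthˣ back′)
        where
        forthᴳ : ∀ a → ∃[ j ] SameOutcome (option G a ⊕ X) (option (H ⊕ X) j)
        forthᴳ a = let (a' , e) = forth a in
          partnerˡ SameOutcome {option G a ⊕ X} H X a' (outcomes e X X∈)
        forthˣ : ∀ b → ∃[ j ] SameOutcome (G ⊕ x b) (option (H ⊕ X) j)
        forthˣ b = partnerʳ SameOutcome {G ⊕ x b} H X b (ih b)
        back′ : ∀ j → (∃[ a ] SameOutcome (option G a ⊕ X) (option (H ⊕ X) j))
                    ⊎ (∃[ b ] SameOutcome (G ⊕ x b) (option (H ⊕ X) j))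
        back′ j with ⊕-option H X j
        ... | inj₁ (a' , eq) = let (a , e) = back a' in
          inj₁ (a , trans (outcomes e X X∈) (cong isP (sym eq)))
        ... | inj₂ (b , eq) = inj₂ (b , trans (ih b) (cong isP (sym eq)))

  ≈-if-options≈ : ∀ {G H K} → Fin (arity G) → Fin (arity H) →
                  (∀ i → option G i ≈ K) → (∀ j → option H j ≈ K) → G ≈ H
  ≈-if-options≈ i₀ j₀ G≈K H≈K = ≈-by-options
    ( (λ i → j₀ , ≈-trans (G≈K i) (≈-sym (H≈K j₀)))
    , (λ j → i₀ , ≈-trans (G≈K i₀) (≈-sym (H≈K j))) )

  record Star : Set where
    field
      S         : Game
      S∈        : A S
      S-nonleaf : Fin (arity S)
      S-options : ∀ a → option S a ≈ leaf

  module StarProperties (star : Star) where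
    open Star star

    isP-S : isP S ≡ true
    isP-S = isP-intro S S-nonleaf (λ a → trans (≈⇒isP (S-options a)) isP-leaf)

    S-option-⊕ : ∀ a {X} → A X → option S a ⊕ X ≈ X
    S-option-⊕ a X∈ = ≈leaf-⊕ X∈ (S-options a)

    isP-S⊕P : ∀ {X} → A X → isP X ≡ true → isP (S ⊕ X) ≡ false
    isP-S⊕P {X} X∈ P-X = let (i , eq) = ⊕-optionˡ S X S-nonleaf in
      isP-false-intro (S ⊕ X) i (trans (cong isP eq) (trans (≈⇒isP (S-option-⊕ S-nonleaf X∈)) P-X))

    isP-S⊕S⊕ : ∀ X → A X → isP (S ⊕ (S ⊕ X)) ≡ isP X
    isP-S⊕S⊕ X@(node _ x) X∈ = from-options (λ b → isP-S⊕S⊕ (x b) (option-closed X∈ b))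
      where
      W = S ⊕ (S ⊕ X)
      S⊕X∈ = sum-closed S∈ X∈
      -- If X is P, each option of W is ≈ S + X or is S + S + x b, and all of these are N.
      -- Otherwise W has a P-option: one ≈ S if X is a leaf, or S + S + x b for a P-option x b.
      from-options : (∀ b → isP (S ⊕ (S ⊕ x b)) ≡ isP (x b)) → isP W ≡ isP X
      from-options ih with isP X in P-X
      ... | true = isP-intro W (proj₁ (⊕-optionˡ S (S ⊕ X) S-nonleaf)) options-N
        where
        options-N : ∀ i → isP (option W i) ≡ false
        options-N i with ⊕-option S (S ⊕ X) i
        ... | inj₁ (a , eq) = trans (cong isP eq) (trans (≈⇒isP (S-option-⊕ a S⊕X∈)) (isP-S⊕P X∈ P-X))
        ... | inj₂ (j , eq) with ⊕-option S X j
        ...   | inj₁ (a , eq′) = trans (cong isP (trans eq (cong (S ⊕_) eq′)))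
                  (trans (≈⇒isP (⊕-congʳ S∈ (S-option-⊕ a X∈))) (isP-S⊕P X∈ P-X))
        ...   | inj₂ (b , eq′) = trans (cong isP (trans eq (cong (S ⊕_) eq′)))
                  (trans (ih b) (isP-option X P-X b))
      ... | false with isP-false-elim X P-X
      ...   | inj₁ X-leaf = let (i , eq) = ⊕-optionˡ S (S ⊕ X) S-nonleaf in
        isP-false-intro W i (trans (cong isP eq) (trans (≈⇒isP (S-option-⊕ S-nonleaf S⊕X∈))
          (trans (Sim-isP (Sim-identityʳ S X X-leaf)) isP-S)))
      ...   | inj₂ (b , P-xb) = let (j , eq) = ⊕-optionʳ S X b ; (i , eq′) = ⊕-optionʳ S (S ⊕ X) j in
        isP-false-intro W i (trans (cong isP (trans eq′ (cong (S ⊕_) eq))) (trans (ih b) P-xb))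

    S⊕S≈leaf : S ⊕ S ≈ leaf
    S⊕S≈leaf = mk≈ λ X X∈ → begin
      isP ((S ⊕ S) ⊕ X)   ≡⟨ Sim-isP (Sim-assoc S S X) ⟩
      isP (S ⊕ (S ⊕ X))   ≡⟨ isP-S⊕S⊕ X X∈ ⟩
      isP X               ≡⟨ Sim-isP (Sim-identityˡ X leaf leaf-isLeaf) ⟨
      isP (leaf ⊕ X)      ∎
      where open ≡-Reasoning

    S⊕S⊕-≈ : ∀ {X} → A X → S ⊕ (S ⊕ X) ≈ X
    S⊕S⊕-≈ {X} X∈ = ≈-trans (Sim⇒≈ (Sim-sym (Sim-assoc S S X))) (≈leaf-⊕ X∈ S⊕S≈leaf)

    options≈leaf⇒≈S : ∀ {G} → Fin (arity G) → (∀ i → option G i ≈ leaf) → G ≈ S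
    options≈leaf⇒≈S i₀ G-options = ≈-if-options≈ i₀ S-nonleaf G-options S-options

    options≈S⇒≈leaf : ∀ {G} → Fin (arity G) → (∀ i → option G i ≈ S) → G ≈ leaf
    options≈S⇒≈leaf i₀ G-options =
      ≈-trans (≈-if-options≈ i₀ (proj₁ (⊕-optionˡ S S S-nonleaf)) G-options S⊕S-options) S⊕S≈leaf
      where
      S⊕S-options : ∀ j → option (S ⊕ S) j ≈ S
      S⊕S-options j with ⊕-option S S j
      ... | inj₁ (a , eq) = subst (_≈ S) (sym eq) (S-option-⊕ a S∈)
      ... | inj₂ (b , eq) = subst (_≈ S) (sym eq)
        (≈-trans (⊕-congʳ S∈ (S-options b)) (Sim⇒≈ (Sim-identityʳ S leaf leaf-isLeaf)))

    copies-parity : ∀ p → copies p S leaf ≈ leaf ⊎ copies p S leaf ≈ S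
    copies-parity zero          = inj₁ ≈-refl
    copies-parity (suc zero)    = inj₂ (Sim⇒≈ (Sim-identityʳ S leaf leaf-isLeaf))
    copies-parity (suc (suc p)) =
      Sum.map (≈-trans two-fewer) (≈-trans two-fewer) (copies-parity p)
      where
      two-fewer : copies (2 + p) S leaf ≈ copies p S leaf
      two-fewer = S⊕S⊕-≈ (copies∈ p S∈ leaf∈)

    leaf≉S : ¬ leaf ≈ S
    leaf≉S e = case trans (sym isP-leaf) (trans (≈⇒isP e) isP-S) of λ ()

    leaf∷S : Fin 2 → Game
    leaf∷S = leaf ∷ S ∷ []

    leaf∷S∈ : ∀ j → A (leaf∷S j)
    leaf∷S∈ fzero        = leaf∈
    leaf∷S∈ (fsuc fzero) = S∈

    leaf∷S-injective : Injective _≡_ _≈_ leaf∷S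
    leaf∷S-injective {fzero}      {fzero}      _ = refl
    leaf∷S-injective {fzero}      {fsuc fzero} e = ⊥-elim (leaf≉S e)
    leaf∷S-injective {fsuc fzero} {fzero}      e = ⊥-elim (leaf≉S (≈-sym e))
    leaf∷S-injective {fsuc fzero} {fsuc fzero} _ = refl

    ≈leaf∷S-cases : ∀ {G} → ∃[ j ] G ≈ leaf∷S j → G ≈ leaf ⊎ G ≈ S
    ≈leaf∷S-cases (fzero      , e) = inj₁ e
    ≈leaf∷S-cases (fsuc fzero , e) = inj₂ e

  record StarTwo (star : Star) : Set where
    field
      T             : Game
      T∈            : A T
      T-options     : ∀ b → option T b ≈ leaf ⊎ option T b ≈ Star.S star
      T-option-leaf : ∃[ b ] option T b ≈ leaf
      T-option-S    : ∃[ b ] option T b ≈ Star.S star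

  -- class is total, as the map φ of a QIso built from it must be.
  record Realises {Q : Set} (_∙_ : Q → Q → Q) (ε : Q) (P : Q → Bool) : Set where
    field
      rep         : Q → Game
      rep∈        : ∀ c → A (rep c)
      class       : Game → Q
      class-resp  : ∀ {G H} → G ≈ H → class G ≡ class H
      class-rep   : ∀ c → class (rep c) ≡ c
      cover       : ∀ {G} → A G → ∃[ c ] G ≈ rep c
      class-rep-⊕ : ∀ c d → class (rep c ⊕ rep d) ≡ c ∙ d
      𝟘≈rep-ε     : 𝟘 ≈ rep ε
      isP-rep     : ∀ c → isP (rep c) ≡ P c

    ≈-rep-class : ∀ {G} → A G → G ≈ rep (class G)
    ≈-rep-class G∈ = let (c , G≈c) = cover G∈ in
      subst (λ d → _ ≈ rep d) (sym (trans (class-resp G≈c) (class-rep c))) G≈c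

    class-⊕ : ∀ {G H} → A G → A H → class (G ⊕ H) ≡ class G ∙ class H
    class-⊕ G∈ H∈ = trans
      (class-resp (≈-trans (⊕-congˡ H∈ (≈-rep-class G∈)) (⊕-congʳ (rep∈ _) (≈-rep-class H∈))))
      (class-rep-⊕ _ _)

    rep-⊕ : ∀ c d → rep c ⊕ rep d ≈ rep (c ∙ d)
    rep-⊕ c d = subst (λ e → _ ≈ rep e) (class-rep-⊕ c d) (≈-rep-class (sum-closed (rep∈ c) (rep∈ d)))

    class-𝟘 : class 𝟘 ≡ ε
    class-𝟘 = trans (class-resp 𝟘≈rep-ε) (class-rep ε)

    isP-class : ∀ {G} → A G → isP G ≡ P (class G)
    isP-class G∈ = trans (≈⇒isP (≈-rep-class G∈)) (isP-rep _)

  Realises⇒QuotientSize : ∀ {k _∙_ ε P} → Realises {Fin k} _∙_ ε P → QuotientSize A k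
  Realises⇒QuotientSize R = rep , rep∈
    , (λ G G∈ → let (c , G≈c) = cover G∈ in c , outcomes G≈c)
    , (λ c d c≈d → trans (sym (class-rep c)) (trans (class-resp (mk≈ c≈d)) (class-rep d)))
    where open Realises R

  realises-trivial : (∀ {G} → A G → G ≈ leaf) → Realises {Fin 1} (λ _ _ → fzero) fzero (λ _ → false)
  realises-trivial ≈leaf = record
    { rep = λ _ → leaf ; rep∈ = λ _ → leaf∈
    ; class = λ _ → fzero ; class-resp = λ _ → refl ; class-rep = λ { fzero → refl }
    ; cover = λ G∈ → fzero , ≈leaf G∈
    ; class-rep-⊕ = λ _ _ → refl
    ; 𝟘≈rep-ε = IsLeaf⇒≈leaf {𝟘} refl
    ; isP-rep = λ _ → isP-leaf }

  realises-star : (st : Star) → (∀ {G} → A G → G ≈ leaf ⊎ G ≈ Star.S st) → Realises _∙₂_ fzero P₂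
  realises-star st leaf-or-S = record
    { rep = leaf∷S ; rep∈ = leaf∷S∈
    ; class = bit ∘ isP ; class-resp = cong bit ∘ ≈⇒isP ; class-rep = class-rep
    ; cover = [ (fzero ,_) , (fsuc fzero ,_) ]′ ∘ leaf-or-S
    ; class-rep-⊕ = λ c d → trans (cong bit (≈⇒isP (rep-⊕ c d))) (class-rep (c ∙₂ d))
    ; 𝟘≈rep-ε = IsLeaf⇒≈leaf {𝟘} refl
    ; isP-rep = isP-rep }
    where
    open Star st
    open StarProperties st

    isP-rep : ∀ c → isP (leaf∷S c) ≡ P₂ c
    isP-rep fzero        = isP-leaf
    isP-rep (fsuc fzero) = isP-S

    class-rep : ∀ c → bit (isP (leaf∷S c)) ≡ c
    class-rep fzero        = cong bit isP-leaf
    class-rep (fsuc fzero) = cong bit isP-S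

    rep-⊕ : ∀ c d → leaf∷S c ⊕ leaf∷S d ≈ leaf∷S (c ∙₂ d)
    rep-⊕ fzero        d            = ≈leaf-⊕ (leaf∷S∈ d) ≈-refl
    rep-⊕ (fsuc fzero) fzero        = Sim⇒≈ (Sim-identityʳ S leaf leaf-isLeaf)
    rep-⊕ (fsuc fzero) (fsuc fzero) = S⊕S≈leaf

  module T₂ (st : Star) (st2 : StarTwo st) where
    open Star st
    open StarTwo st2
    open StarProperties st
    open Sums leaf S T leaf-isLeaf

    ⟪⟫∈ : ∀ p q → A ⟪ p , q ⟫
    ⟪⟫∈ p q = copies∈ p S∈ (copies∈ q T∈ leaf∈)

    kills : ∀ {G} → G ≈ leaf → ∀ q → G ⊕ ⟪ 0 , q ⟫ ≈ ⟪ 0 , q ⟫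
    kills G≈leaf q = ≈leaf-⊕ (⟪⟫∈ 0 q) G≈leaf

    acts-as-S : ∀ {G} → G ≈ S → ∀ q → G ⊕ ⟪ 0 , q ⟫ ≈ ⟪ 1 , q ⟫
    acts-as-S G≈S q = ⊕-congˡ (⟪⟫∈ 0 q) G≈S

    open Outcomes _≈_ ≈-trans Sim⇒≈ ≈⇒isP (⊕-congʳ S∈) (⊕-congʳ T∈) S-nonleaf
      (λ a p q → S-option-⊕ a (⟪⟫∈ p q)) (λ b → Sum.map kills acts-as-S (T-options b))
      (Product.map₂ kills T-option-leaf) (Product.map₂ acts-as-S T-option-S)
      using (isP-⟪⟫; isP-⟪⟫-⊕)

    rep₆ : Fin 6 → Game
    rep₆ c = ⟪ p-of c , q-of c ⟫

    rep₆∈ : ∀ c → A (rep₆ c)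
    rep₆∈ c = ⟪⟫∈ (p-of c) (q-of c)

    isP-rep₆-⊕ : ∀ c k → isP (rep₆ c ⊕ rep₆ k) ≡ table₆ c k
    isP-rep₆-⊕ c k = isP-⟪⟫-⊕ (p-of c) (q-of c) (p-of k) (q-of k)

    rep₆-injective : Injective _≡_ _≈_ rep₆
    rep₆-injective {c} {d} c≈d = table₆-injective λ k →
      trans (sym (isP-rep₆-⊕ c k)) (trans (outcomes c≈d (rep₆ k) (rep₆∈ k)) (isP-rep₆-⊕ d k))

    class₆ : Game → Fin 6
    class₆ G = decode (λ k → isP (G ⊕ rep₆ k))

    realises-T₂ : (∀ {G} → A G → ∃[ c ] G ≈ rep₆ c) → Realises _∙₆_ fzero P₆
    realises-T₂ cover = record
      { rep = rep₆ ; rep∈ = rep₆∈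
      ; class = class₆
      ; class-resp = λ G≈H → decode-cong λ k → outcomes G≈H (rep₆ k) (rep₆∈ k)
      ; class-rep = λ c → trans (decode-cong (isP-rep₆-⊕ c)) (decode-table₆ c)
      ; cover = cover
      ; class-rep-⊕ = λ c d → decode-cong λ k → trans
          (Sim-isP (Sim-⊕ (⟪⟫-⊕ (p-of c) (q-of c) (p-of d) (q-of d)) Sim-refl))
          (isP-⟪⟫-⊕ (p-of c + p-of d) (q-of c + q-of d) (p-of k) (q-of k))
      ; 𝟘≈rep-ε = IsLeaf⇒≈leaf {𝟘} refl
      ; isP-rep = λ c → isP-⟪⟫ (p-of c) (q-of c) }

  Outside : ∀ {m} → (Fin m → Game) → Game → Set
  Outside h G = ∀ j → ¬ G ≈ h j

  module Counting {k} (qs : QuotientSize A k) where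
    private
      rep : Fin k → Game
      rep = proj₁ qs

      rep∈ : ∀ i → A (rep i)
      rep∈ = proj₁ (proj₂ qs)

      index : ∀ {G} → A G → Fin k
      index {G} G∈ = proj₁ (proj₁ (proj₂ (proj₂ qs)) G G∈)

      ≈-rep-index : ∀ {G} (G∈ : A G) → G ≈ rep (index G∈)
      ≈-rep-index {G} G∈ = mk≈ (proj₂ (proj₁ (proj₂ (proj₂ qs)) G G∈))

      rep-injective : Injective _≡_ _≈_ rep
      rep-injective {i} {j} e = proj₂ (proj₂ (proj₂ qs)) i j (outcomes e)

      index-≡⇒≈ : ∀ {G H} (G∈ : A G) (H∈ : A H) → index G∈ ≡ index H∈ → G ≈ H
      index-≡⇒≈ G∈ H∈ eq =
        ≈-trans (≈-rep-index G∈) (subst (λ i → rep i ≈ _) (sym eq) (≈-sym (≈-rep-index H∈)))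

    ≈-dec : ∀ {G H} → A G → A H → Dec (G ≈ H)
    ≈-dec G∈ H∈ with index G∈ ≟ index H∈
    ... | yes eq  = yes (index-≡⇒≈ G∈ H∈ eq)
    ... | no  neq = no λ e → neq (rep-injective
            (≈-trans (≈-sym (≈-rep-index G∈)) (≈-trans e (≈-rep-index H∈))))

    family-bound : ∀ {m} (g : Fin m → Game) → (∀ i → A (g i)) → Injective _≡_ _≈_ g → m ≤ k
    family-bound g g∈ g-injective =
      injective⇒≤ {f = λ i → index (g∈ i)} (λ eq → g-injective (index-≡⇒≈ (g∈ _) (g∈ _) eq))

    covers : (g : Fin k → Game) → (∀ i → A (g i)) → Injective _≡_ _≈_ g →
             ∀ {G} → A G → ∃[ i ] G ≈ g i
    covers g g∈ g-injective {G} G∈ with any? (λ i → ≈-dec G∈ (g∈ i))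
    ... | yes found = found
    ... | no  none  = ⊥-elim (1+n≰n (family-bound (G ∷ g) G∷g∈ G∷g-injective))
      where
      G∷g∈ : ∀ i → A ((G ∷ g) i)
      G∷g∈ fzero    = G∈
      G∷g∈ (fsuc i) = g∈ i
      G∷g-injective : Injective _≡_ _≈_ (G ∷ g)
      G∷g-injective {fzero}  {fzero}  _ = refl
      G∷g-injective {fzero}  {fsuc j} e = ⊥-elim (none (j , e))
      G∷g-injective {fsuc i} {fzero}  e = ⊥-elim (none (i , ≈-sym e))
      G∷g-injective {fsuc i} {fsuc j} e = cong fsuc (g-injective e)

    outside? : ∀ {m} {h : Fin m → Game} → (∀ j → A (h j)) → ∀ {G} → A G → Dec (Outside h G)
    outside? h∈ G∈ = all? (λ j → ¬? (≈-dec G∈ (h∈ j)))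

    inside : ∀ {m} {h : Fin m → Game} → (∀ j → A (h j)) → ∀ {G} → A G →
             ¬ Outside h G → ∃[ j ] G ≈ h j
    inside h∈ G∈ not-outside =
      let (j , ¬¬G≈hⱼ) = ¬∀⟶∃¬ _ _ (λ j → ¬? (≈-dec G∈ (h∈ j))) not-outside
      in j , decidable-stable (≈-dec G∈ (h∈ j)) ¬¬G≈hⱼ

    escape : ∀ {m} → m < k → (h : Fin m → Game) → (∀ j → A (h j)) → ∃[ G ] A G × Outside h G
    escape m<k h h∈ with any? (λ i → outside? h∈ (rep∈ i))
    ... | yes (i , out) = rep i , rep∈ i , out
    ... | no  none      = ⊥-elim (<⇒≱ m<k (injective⇒≤ {f = proj₁ ∘ partner} partner-injective))
      where
      partner : ∀ i → ∃[ j ] rep i ≈ h j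
      partner i = inside h∈ (rep∈ i) (none ∘ (i ,_))
      partner-injective : Injective _≡_ _≡_ (proj₁ ∘ partner)
      partner-injective {i} {i'} eq = rep-injective (≈-trans (proj₂ (partner i))
        (subst (λ j → h j ≈ rep i') (sym eq) (≈-sym (proj₂ (partner i')))))

    minimal-outside : ∀ {m} (h : Fin m → Game) → (∀ j → A (h j)) → ∀ {G} → A G → Outside h G →
                      ∃[ H ] A H × Outside h H × (∀ i → ∃[ j ] option H i ≈ h j)
    minimal-outside h h∈ {node n g} G∈ out with any? (λ i → outside? h∈ (option-closed G∈ i))
    ... | yes (i , outᵢ) = minimal-outside h h∈ {g i} (option-closed G∈ i) outᵢ
    ... | no  none       = node n g , G∈ , out , λ i → inside h∈ (option-closed G∈ i) (none ∘ (i ,_))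

    star : 1 < k → Star
    star 1<k =
      let (G₀ , G₀∈ , G₀-out) = escape 1<k (λ _ → leaf) (λ _ → leaf∈)
          (S , S∈ , S-out , S-inside) = minimal-outside (λ _ → leaf) (λ _ → leaf∈) G₀∈ G₀-out
      in record { S = S ; S∈ = S∈ ; S-nonleaf = nonleaf S (S-out fzero ∘ IsLeaf⇒≈leaf)
                ; S-options = proj₂ ∘ S-inside }

    module _ (st : Star) where
      open Star st
      open StarProperties st

      minimal⇒StarTwo : (∃[ T ] A T × Outside leaf∷S T × (∀ b → ∃[ j ] option T b ≈ leaf∷S j)) →
                        StarTwo st
      minimal⇒StarTwo (T , T∈ , T-out , T-inside) = record
        { T = T ; T∈ = T∈ ; T-options = T-options
        ; T-option-leaf = leaf-option ; T-option-S = S-option }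
        where
        T-options : ∀ b → option T b ≈ leaf ⊎ option T b ≈ S
        T-options = ≈leaf∷S-cases ∘ T-inside

        T-nonleaf : Fin (arity T)
        T-nonleaf = nonleaf T (T-out fzero ∘ IsLeaf⇒≈leaf)

        leaf-option : ∃[ b ] option T b ≈ leaf
        leaf-option with any? (λ b → ≈-dec (option∈ T∈ b) leaf∈)
        ... | yes found = found
        ... | no  none  = ⊥-elim (T-out fzero (options≈S⇒≈leaf T-nonleaf
                            λ b → [ ⊥-elim ∘ none ∘ (b ,_) , id ]′ (T-options b)))

        S-option : ∃[ b ] option T b ≈ S
        S-option with any? (λ b → ≈-dec (option∈ T∈ b) S∈)
        ... | yes found = found
        ... | no  none  = ⊥-elim (T-out (fsuc fzero) (options≈leaf⇒≈S T-nonleaf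
                            λ b → [ id , ⊥-elim ∘ none ∘ (b ,_) ]′ (T-options b)))

      star-two : 2 < k → StarTwo st
      star-two 2<k = let (G₀ , G₀∈ , G₀-out) = escape 2<k leaf∷S leaf∷S∈ in
        minimal⇒StarTwo (minimal-outside leaf∷S leaf∷S∈ G₀∈ G₀-out)

    three-classes⇒six : 2 < k → 6 ≤ k
    three-classes⇒six 2<k = family-bound rep₆ rep₆∈ rep₆-injective
      where
      st = star (<⇒≤ 2<k)
      open T₂ st (star-two st 2<k)

  realises-size-1 : QuotientSize A 1 → Realises {Fin 1} (λ _ _ → fzero) fzero (λ _ → false)
  realises-size-1 qs =
    realises-trivial (proj₂ ∘ covers (λ _ → leaf) (λ _ → leaf∈) λ { {fzero} {fzero} _ → refl })
    where open Counting qs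

  realises-size-2 : QuotientSize A 2 → Realises _∙₂_ fzero P₂
  realises-size-2 qs = realises-star st (≈leaf∷S-cases ∘ covers leaf∷S leaf∷S∈ leaf∷S-injective)
    where
    open Counting qs
    st = star (s≤s (s≤s z≤n))
    open StarProperties st

  realises-size-6 : QuotientSize A 6 → Realises _∙₆_ fzero P₆
  realises-size-6 qs = realises-T₂ (covers rep₆ rep₆∈ rep₆-injective)
    where
    open Counting qs
    st = star (s≤s (s≤s z≤n))
    open T₂ st (star-two st (s≤s (s≤s (s≤s z≤n))))

realisations-iso : ∀ {A B} (clA : Closed A) (clB : Closed B) {Q} {_∙_ : Q → Q → Q} {ε P} →
  ClosedSet.Realises clA _∙_ ε P → ClosedSet.Realises clB _∙_ ε P → QIso A B
realisations-iso {A} {B} clA clB {_∙_ = _∙_} {ε} RA RB = record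
  { φ      = φ
  ; φ-into = λ _ → RB.rep∈ _
  ; φ-wd   = λ _ _ G≈H → B.outcomes (≡⇒≈ᴮ (cong RB.rep (RA.class-resp (A.mk≈ G≈H))))
  ; φ-inj  = λ {G} {H} G∈ H∈ φG≈φH → A.outcomes (begin
      G                     ≈⟨ RA.≈-rep-class G∈ ⟩
      RA.rep (RA.class G)   ≡⟨ cong RA.rep (same-class (B.mk≈ φG≈φH)) ⟩
      RA.rep (RA.class H)   ≈⟨ RA.≈-rep-class H∈ ⟨
      H                     ∎)
  ; φ-surj = λ {K} K∈ → RA.rep (RB.class K) , RA.rep∈ _ , B.outcomes
      (subst (λ c → RB.rep c B.≈ K) (sym (RA.class-rep _)) (B.≈-sym (RB.≈-rep-class K∈)))
  ; φ-hom  = λ {G} {H} G∈ H∈ → B.outcomes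
      (subst (λ c → RB.rep c B.≈ φ G ⊕ φ H) (sym (RA.class-⊕ G∈ H∈)) (B.≈-sym (RB.rep-⊕ _ _)))
  ; φ-unit = λ {G} _ G≈𝟘 → B.outcomes
      (subst (λ c → RB.rep c B.≈ 𝟘) (sym (trans (RA.class-resp (A.mk≈ G≈𝟘)) RA.class-𝟘))
             (B.≈-sym RB.𝟘≈rep-ε))
  ; φ-P    = λ G∈ → trans (RA.isP-class G∈) (sym (RB.isP-rep _))
  }
  where
  module A = ClosedSet clA
  module B = ClosedSet clB
  module RA = A.Realises RA
  module RB = B.Realises RB
  open A.≈-Reasoning

  φ : Game → Game
  φ G = RB.rep (RA.class G)

  ≡⇒≈ᴮ : ∀ {G H} → G ≡ H → G B.≈ H
  ≡⇒≈ᴮ refl = B.≈-refl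

  same-class : ∀ {G H} → φ G B.≈ φ H → RA.class G ≡ RA.class H
  same-class φG≈φH = trans (sym (RB.class-rep _)) (trans (RB.class-resp φG≈φH) (RB.class-rep _))

exactly-one : ∀ {k} {_∙_ : Fin k → Fin k → Fin k} {ε P} →
  (∃[ A ] Σ (Closed A) λ cl → ClosedSet.Realises cl _∙_ ε P) →
  (∀ {A} (cl : Closed A) → QuotientSize A k → ClosedSet.Realises cl _∙_ ε P) →
  ExactlyOneQuotientOfSize k
exactly-one (A , cl , R) realises =
  (A , cl , ClosedSet.Realises⇒QuotientSize cl R) ,
  λ A B clA clB qsA qsB → realisations-iso clA clB (realises clA qsA) (realises clB qsB)

-- Sums of nim-heaps

nim₁ : Game
nim₁ = node 1 (λ _ → 𝟘)

nim₂ : Game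
nim₂ = node 2 (𝟘 ∷ nim₁ ∷ [])

open Sums 𝟘 nim₁ nim₂ refl using (⟪_,_⟫; ⟪⟫-⊕; module Outcomes)

nim₂-option : ∀ b → (∀ q → Sim (option nim₂ b ⊕ ⟪ 0 , q ⟫) ⟪ 0 , q ⟫)
                  ⊎ (∀ q → Sim (option nim₂ b ⊕ ⟪ 0 , q ⟫) ⟪ 1 , q ⟫)
nim₂-option fzero        = inj₁ λ q → Sim-identityˡ ⟪ 0 , q ⟫ 𝟘 refl
nim₂-option (fsuc fzero) = inj₂ λ _ → Sim-refl

open Outcomes Sim Sim-trans id Sim-isP (Sim-⊕ Sim-refl) (Sim-⊕ Sim-refl) fzero
  (λ _ p q → Sim-identityˡ ⟪ p , q ⟫ 𝟘 refl) nim₂-option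
  (fzero , λ q → Sim-identityˡ ⟪ 0 , q ⟫ 𝟘 refl) (fsuc fzero , λ _ → Sim-refl)
  using (option-move; isP-⟪⟫-⊕)

-- Up to Sim, the closures of 0, * and *2.
Heaps≤0 Heaps≤1 Heaps≤2 : Game → Set
Heaps≤0 G = Sim G 𝟘
Heaps≤1 G = ∃[ p ] Sim G ⟪ p , 0 ⟫
Heaps≤2 G = ∃[ p ] ∃[ q ] Sim G ⟪ p , q ⟫

heaps≤0-closed : Closed Heaps≤0
heaps≤0-closed = record
  { nonempty      = 𝟘 , Sim-refl
  ; sum-closed    = λ G~𝟘 H~𝟘 → Sim-trans (Sim-⊕ G~𝟘 H~𝟘) (Sim-identityʳ 𝟘 𝟘 refl)
  ; option-closed = λ { (sim (forth , _)) i → ⊥-elim (¬Fin0 (proj₁ (forth i))) } }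

Move-q₀ : ∀ {p p' q'} → Move p 0 p' q' → q' ≡ 0
Move-q₀ S-move = refl

heaps≤1-closed : Closed Heaps≤1
heaps≤1-closed = record
  { nonempty      = 𝟘 , 0 , Sim-refl
  ; sum-closed    = λ { (p , G~) (p' , H~) → p + p' , Sim-trans (Sim-⊕ G~ H~) (⟪⟫-⊕ p 0 p' 0) }
  ; option-closed = λ { (p , sim (forth , _)) i →
      let (j , s) = forth i ; (p' , q' , mv , s') = option-move p 0 j in
      p' , Sim-trans s (subst (λ q → Sim (option ⟪ p , 0 ⟫ j) ⟪ p' , q ⟫) (Move-q₀ mv) s') } }

heaps≤2-closed : Closed Heaps≤2
heaps≤2-closed = record
  { nonempty      = 𝟘 , 0 , 0 , Sim-refl
  ; sum-closed    = λ { (p , q , G~) (p' , q' , H~) →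
      p + p' , q + q' , Sim-trans (Sim-⊕ G~ H~) (⟪⟫-⊕ p q p' q') }
  ; option-closed = λ { (p , q , sim (forth , _)) i →
      let (j , s) = forth i ; (p' , q' , _ , s') = option-move p q j in p' , q' , Sim-trans s s' } }

nim₁-star : ∀ {A} (cl : Closed A) → A nim₁ → ClosedSet.Star cl
nim₁-star cl nim₁∈ = record
  { S = nim₁ ; S∈ = nim₁∈ ; S-nonleaf = fzero ; S-options = λ _ → IsLeaf⇒≈leaf refl }
  where open ClosedSet cl

-- In these closed sets leaf computes to 𝟘, which the proofs below use silently.
heaps≤0-realises : ClosedSet.Realises heaps≤0-closed {Fin 1} (λ _ _ → fzero) fzero (λ _ → false)
heaps≤0-realises = realises-trivial Sim⇒≈
  where open ClosedSet heaps≤0-closed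

heaps≤1-realises : ClosedSet.Realises heaps≤1-closed _∙₂_ fzero P₂
heaps≤1-realises = realises-star st λ (p , G~) →
  Sum.map (≈-trans (Sim⇒≈ G~)) (≈-trans (Sim⇒≈ G~)) (copies-parity p)
  where
  open ClosedSet heaps≤1-closed
  st = nim₁-star heaps≤1-closed (1 , Sim-sym (Sim-identityʳ nim₁ 𝟘 refl))
  open StarProperties st

heaps≤2-realises : ClosedSet.Realises heaps≤2-closed _∙₆_ fzero P₆
heaps≤2-realises = realises-T₂ cover
  where
  open ClosedSet heaps≤2-closed
  st = nim₁-star heaps≤2-closed (1 , 0 , Sim-sym (Sim-identityʳ nim₁ 𝟘 refl))
  st2 : StarTwo st
  st2 = record
    { T = nim₂ ; T∈ = 0 , 1 , Sim-sym (Sim-identityʳ nim₂ 𝟘 refl)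
    ; T-options = λ { fzero → inj₁ (IsLeaf⇒≈leaf refl) ; (fsuc fzero) → inj₂ ≈-refl }
    ; T-option-leaf = fzero , IsLeaf⇒≈leaf refl ; T-option-S = fsuc fzero , ≈-refl }
  open T₂ st st2 using (rep₆; realises-T₂)

  cover : ∀ {G} → Heaps≤2 G → ∃[ c ] G ≈ rep₆ c
  cover (p , q , G~) = let (c , same) = representative p q in c , ≈-trans (Sim⇒≈ G~) (mk≈ λ where
    X (p' , q' , X~) → begin
      isP (⟪ p , q ⟫ ⊕ X)              ≡⟨ Sim-isP (Sim-⊕ (Sim-refl {⟪ p , q ⟫}) X~) ⟩
      isP (⟪ p , q ⟫ ⊕ ⟪ p' , q' ⟫)     ≡⟨ isP-⟪⟫-⊕ p q p' q' ⟩
      inP (p + p') (q + q')            ≡⟨ same p' q' ⟩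
      inP (p-of c + p') (q-of c + q')  ≡⟨ isP-⟪⟫-⊕ (p-of c) (q-of c) p' q' ⟨
      isP (rep₆ c ⊕ ⟪ p' , q' ⟫)       ≡⟨ Sim-isP (Sim-⊕ (Sim-refl {rep₆ c}) X~) ⟨
      isP (rep₆ c ⊕ X)                 ∎)
    where open ≡-Reasoning

corollary4p10 : ((A : Game → Set) → Closed A → ¬ QuotientSize A 4)
                  × ExactlyOneQuotientOfSize 1
                  × ExactlyOneQuotientOfSize 2
                  × ExactlyOneQuotientOfSize 6
corollary4p10 =
  (λ A cl qs → <⇒≱ (s≤s (s≤s (s≤s (s≤s (s≤s z≤n)))))
                 (ClosedSet.Counting.three-classes⇒six cl qs (s≤s (s≤s (s≤s z≤n))))) ,
  exactly-one (Heaps≤0 , heaps≤0-closed , heaps≤0-realises) ClosedSet.realises-size-1 ,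
  exactly-one (Heaps≤1 , heaps≤1-closed , heaps≤1-realises) ClosedSet.realises-size-2 ,
  exactly-one (Heaps≤2 , heaps≤2-closed , heaps≤2-realises) ClosedSet.realises-size-6
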